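{- Let $k\ge0$ be an integer and $H$ a finite $r$-uniform hypergraph. (1) If $H$ is $k$-degenerate, then ${\rm Mad}(H)\le rk$. (2) If $H$ is $(r(k+1)-1)$-degenerate, then $V(H)$ can be partitioned into $r$ pairwise disjoint (possibly empty) subsets $A_1,\dots,A_r$ such that the induced subhypergraph $H[A_i]$ is $k$-degenerate for each $1\le i\le r$.
   Context: A hypergraph is $d$-degenerate if every induced subhypergraph (including itself) has a vertex whose degree in that subhypergraph is at most $d$. For $F\subseteq V(H)$, $e(F)$ is the number of edges contained in $F$, and ${\rm Mad}(H)=\max\{r\,e(F)/|F|:\emptyset\ne F\subseteq V(H)\}$. -}

module Defs where

open import Data.Nat using (ℕ; _≤_; _*_)
open import Data.Fin using (Fin; _≟_)
open import Data.Vec using (tabulate)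
open import Data.Bool using (if_then_else_)
open import Relation.Nullary using (does)
open import Data.Fin.Subset using (Subset; inside; outside; _∈_; _⊆_; ∣_∣; Nonempty; ⊤)
open import Data.Fin.Subset.Properties using (_∈?_; _⊆?_)
open import Data.List using (List; length; filter)
open import Data.List.Relation.Unary.All using (All)
open import Data.List.Relation.Unary.Unique.Propositional using (Unique)
open import Data.Product using (Σ; _×_)
open import Relation.Binary.PropositionalEquality using (_≡_)
open import Relation.Nullary.Decidable using (_×-dec_)

record Hypergraph (r : ℕ) : Set where
  field
    n        : ℕ
    edges    : List (Subset n)
    uniform  : All (λ e → ∣ e ∣ ≡ r) edges
    distinct : Unique edges
open Hypergraph public

e : ∀ {r} (H : Hypergraph r) → Subset (n H) → ℕ
e H F = length (filter (λ x → x ⊆? F) (edges H))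

deg : ∀ {r} (H : Hypergraph r) → Subset (n H) → Fin (n H) → ℕ
deg H S v = length (filter (λ x → (v ∈? x) ×-dec (x ⊆? S)) (edges H))

-- H[A] is d-degenerate: every nonempty induced subhypergraph H[S] of H[A]
-- (S ⊆ A) has a vertex of degree at most d in H[S].
DegenerateOn : ∀ {r} (H : Hypergraph r) → Subset (n H) → ℕ → Set
DegenerateOn H A d =
  ∀ (S : Subset (n H)) → S ⊆ A → Nonempty S →
  Σ (Fin (n H)) (λ v → v ∈ S × deg H S v ≤ d)

Degenerate : ∀ {r} (H : Hypergraph r) → ℕ → Set
Degenerate H d = DegenerateOn H ⊤ d

-- Mad(H) ≤ c  (c a natural number):  r·e(F)/|F| ≤ c for every nonempty F,
-- written multiplicatively as r·e(F) ≤ c·|F|.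
Mad≤ : ∀ {r} (H : Hypergraph r) → ℕ → Set
Mad≤ {r} H c = ∀ (F : Subset (n H)) → Nonempty F → r * e H F ≤ c * ∣ F ∣

-- the class A_i = {v : f v = i} of the partition of V(H) given by f : V(H) → Fin r
class : ∀ {r} (H : Hypergraph r) → (Fin (n H) → Fin r) → Fin r → Subset (n H)
class H f i = tabulate (λ v → if does (f v ≟ i) then inside else outside)

module Submission where

-- Both parts remove, one at a time, a vertex v of degree at most d in what
-- is left (degenerate-ind).  (1) Removing v from F loses at most k edges, so
-- e(F) ≤ k|F|.  (2) Partition T - v by induction.  An edge through v lies in
-- T ∩ (A_j ∪ {v}) for at most one j, because it has r ≥ 2 vertices whenever
-- there are two classes; so the degrees of v into these r extended classes
-- add up to at most deg_T(v) < r(k+1), and by pigeonhole v can join a class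
-- A_j in which its degree is at most k.

open import Defs
open import Data.Nat using (ℕ; _≤_; _*_; _+_; _∸_; zero; suc; _<_; z≤n; s≤s; z<s; _≤?_)
open import Data.Nat.Properties
  using (module ≤-Reasoning; ≤-trans; ≤-reflexive; ≰⇒>; n<1⇒n≡0; <⇒≢; +-mono-≤; +-monoʳ-≤; +-monoˡ-≤; +-suc; +-comm;
         +-cancelˡ-<; *-cancelʳ-<; ≤-<-trans; *-suc; *-assoc; *-monoʳ-≤; m≤m*n; ∸-monoʳ-<; +-0-commutativeMonoid)
open import Data.Nat.Induction using (<-wellFounded)
open import Data.Fin using (Fin; zero; suc; _≟_; toℕ; fromℕ<)
open import Data.Fin.Properties using (0≢1+n; suc-injective; toℕ-injective; toℕ<n)
open import Data.Fin.Subset using (Subset; inside; outside; _∈_; _⊆_; ∣_∣; Empty; ⊤; ⁅_⁆; _∩_; _∪_; _-_)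
open import Data.Fin.Subset.Properties
  using (_∈?_; _⊆?_; nonempty?; ⊆⊤; ∈⊤; x∈⁅x⁆; x∈⁅y⁆⇒x≡y; ∣⁅x⁆∣≡1; p⊆q⇒∣p∣≤∣q∣; ∣⊥∣≡0; Empty-unique;
         x∈p∩q⁺; x∈p∩q⁻; x∈p∪q⁺; x∈p∪q⁻; p─q⊆p; x∈p∧x≢y⇒x∈p-y; x∈p⇒∣p-x∣<∣p∣)
open import Data.Vec.Properties using (lookup∘tabulate; []=⇒lookup; lookup⇒[]=)
open import Data.Vec.Functional using (updateAt)
open import Data.Vec.Functional.Properties using (updateAt-updates; updateAt-minimal)
open import Data.List using (List; []; _∷_; [_]; length; filter)
open import Data.List.Properties using (filter-reject; filter-none)
open import Data.List.Relation.Unary.All as All using (All)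
import Data.List.Relation.Binary.Sublist.Propositional as Sublist
import Data.List.Relation.Binary.Sublist.Propositional.Properties as Sublist
open import Algebra.Properties.CommutativeMonoid.Sum +-0-commutativeMonoid
  using (sum-syntax; ∑-distrib-+; sum-cong-≗; sum-replicate-zero)
open import Data.Product using (Σ; ∃; _×_; _,_; proj₁; proj₂)
open import Data.Sum using (_⊎_; inj₁; inj₂)
open import Data.Bool using (if_then_else_)
open import Function using (_∘_; const)
open import Induction.WellFounded using (Acc; acc)
open import Relation.Nullary using (yes; no; ¬_; contradiction)
open import Relation.Nullary.Decidable using (_×-dec_; dec-true)
open import Relation.Unary using (Decidable)
open import Relation.Binary.PropositionalEquality using (_≡_; _≢_; refl; sym; trans; cong; subst)

private
  variable
    A : Set
    P Q R : A → Set
    x : A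
    xs ys : List A

length-filter-⊆ : (P? : Decidable P) (Q? : Decidable Q) → (∀ {x} → P x → Q x) →
  xs Sublist.⊆ ys → length (filter P? xs) ≤ length (filter Q? ys)
length-filter-⊆ P? Q? P⇒Q xs⊆ys =
  Sublist.length-mono-≤ (Sublist.filter⁺ P? Q? (λ { refl → P⇒Q }) xs⊆ys)

length-filter-≤-∷ : (P? : Decidable P) → length (filter P? xs) ≤ length (filter P? (x ∷ xs))
length-filter-≤-∷ {x = x} P? = length-filter-⊆ P? P? (λ p → p) (x Sublist.∷ʳ Sublist.⊆-refl)

length-filter-⊎ : (P? : Decidable P) (Q? : Decidable Q) (R? : Decidable R) →
  (∀ {x} → P x → Q x ⊎ R x) →
  ∀ xs → length (filter P? xs) ≤ length (filter Q? xs) + length (filter R? xs)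
length-filter-⊎ P? Q? R? split [] = z≤n
length-filter-⊎ P? Q? R? split (x ∷ xs) with ih ← length-filter-⊎ P? Q? R? split xs | P? x
... | no _ = ≤-trans ih (+-mono-≤ (length-filter-≤-∷ Q?) (length-filter-≤-∷ R?))
... | yes p with Q? x
...   | yes _ = s≤s (≤-trans ih (+-monoʳ-≤ _ (length-filter-≤-∷ R?)))
...   | no ¬q with R? x
...     | yes _ = ≤-trans (s≤s ih) (≤-reflexive (sym (+-suc _ _)))
...     | no ¬r with split p
...       | inj₁ q = contradiction q ¬q
...       | inj₂ r = contradiction r ¬r

length-filter-∷ : (P? : Decidable P) →
  length (filter P? (x ∷ xs)) ≡ length (filter P? [ x ]) + length (filter P? xs)
length-filter-∷ {x = x} P? with P? x
... | yes _ = refl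
... | no _  = refl

∑-length-filter-[x]≤ : ∀ m {P : Fin m → A → Set} (P? : ∀ j → Decidable (P j)) (Q? : Decidable Q) →
  (∀ {j} → P j x → Q x) → (∀ {i j} → P i x → P j x → i ≡ j) →
  ∑[ j < m ] length (filter (P? j) [ x ]) ≤ length (filter Q? [ x ])
∑-length-filter-[x]≤ zero P? Q? P⇒Q unique = z≤n
∑-length-filter-[x]≤ {x = x} (suc m) P? Q? P⇒Q unique with P? zero x
... | no _ = ∑-length-filter-[x]≤ m (P? ∘ suc) Q? P⇒Q (λ p p′ → suc-injective (unique p p′))
... | yes p with Q? x
...   | no ¬q = contradiction (P⇒Q p) ¬q
...   | yes _ = s≤s (≤-reflexive (trans (sum-cong-≗ rejected) (sum-replicate-zero m)))
  where
  rejected : ∀ j → length (filter (P? (suc j)) [ x ]) ≡ 0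
  rejected j = cong length (filter-reject (P? (suc j)) (0≢1+n ∘ unique p))

∑-length-filter≤ : ∀ {m} {P : Fin m → A → Set} (P? : ∀ j → Decidable (P j)) (Q? : Decidable Q) →
  (∀ {j x} → P j x → Q x) → All (λ x → ∀ {i j} → P i x → P j x → i ≡ j) xs →
  ∑[ j < m ] length (filter (P? j) xs) ≤ length (filter Q? xs)
∑-length-filter≤ {m = m} P? Q? P⇒Q All.[] = ≤-reflexive (sum-replicate-zero m)
∑-length-filter≤ {xs = x ∷ xs} {m = m} P? Q? P⇒Q (unique All.∷ uniques) = begin
  ∑[ j < m ] length (filter (P? j) (x ∷ xs))
    ≡⟨ sum-cong-≗ (λ j → length-filter-∷ (P? j)) ⟩
  ∑[ j < m ] (length (filter (P? j) [ x ]) + length (filter (P? j) xs))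
    ≡⟨ ∑-distrib-+ (λ j → length (filter (P? j) [ x ])) (λ j → length (filter (P? j) xs)) ⟩
  ∑[ j < m ] length (filter (P? j) [ x ]) + ∑[ j < m ] length (filter (P? j) xs)
    ≤⟨ +-mono-≤ (∑-length-filter-[x]≤ m P? Q? P⇒Q unique) (∑-length-filter≤ P? Q? P⇒Q uniques) ⟩
  length (filter Q? [ x ]) + length (filter Q? xs)
    ≡⟨ length-filter-∷ Q? ⟨
  length (filter Q? (x ∷ xs)) ∎
  where open ≤-Reasoning

pigeonhole-∑ : ∀ m k (g : Fin m → ℕ) → ∑[ j < m ] g j < m * suc k → ∃ λ j → g j ≤ k
pigeonhole-∑ zero k g ()
pigeonhole-∑ (suc m) k g ∑g< with g zero ≤? k
... | yes g₀≤k = zero , g₀≤k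
... | no g₀≰k = let j , gⱼ≤k = pigeonhole-∑ m k (g ∘ suc) ∑g∘suc< in suc j , gⱼ≤k
  where
  ∑g∘suc< : ∑[ j < m ] g (suc j) < m * suc k
  ∑g∘suc< = +-cancelˡ-< (suc k) _ _ (≤-<-trans (+-monoˡ-≤ _ (≰⇒> g₀≰k)) ∑g<)

Fin-unique : ∀ {m} → m ≤ 1 → (i j : Fin m) → i ≡ j
Fin-unique m≤1 i j = toℕ-injective (trans (toℕ≡0 i) (sym (toℕ≡0 j)))
  where
  toℕ≡0 : ∀ i → toℕ i ≡ 0
  toℕ≡0 i = n<1⇒n≡0 (≤-trans (toℕ<n i) m≤1)

module _ {r : ℕ} (H : Hypergraph r) where

  private
    V : Set
    V = Fin (n H)

    incident? : (S : Subset (n H)) (v : V) → Decidable (λ x → v ∈ x × x ⊆ S)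
    incident? S v x = (v ∈? x) ×-dec (x ⊆? S)

  deg-mono : ∀ {S T} v → S ⊆ T → deg H S v ≤ deg H T v
  deg-mono {S} {T} v S⊆T = length-filter-⊆ (incident? S v) (incident? T v)
    (λ (v∈x , x⊆S) → v∈x , λ u∈x → S⊆T (x⊆S u∈x)) (Sublist.⊆-refl {x = edges H})

  e-empty : 1 ≤ r → ∀ {F} → Empty F → e H F ≡ 0
  e-empty r≥1 {F} F-empty = cong length (filter-none (_⊆? F) (All.map not⊆F (uniform H)))
    where
    not⊆F : ∀ {x} → ∣ x ∣ ≡ r → ¬ x ⊆ F
    not⊆F {x} ∣x∣≡r x⊆F = <⇒≢ r≥1 (trans (sym ∣x∣≡0) ∣x∣≡r)
      where
      ∣x∣≡0 : ∣ x ∣ ≡ 0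
      ∣x∣≡0 = trans (cong ∣_∣ (Empty-unique (λ (u , u∈x) → F-empty (u , x⊆F u∈x)))) (∣⊥∣≡0 (n H))

  e≤e[F-v]+deg : ∀ F v → e H F ≤ e H (F - v) + deg H F v
  e≤e[F-v]+deg F v =
    length-filter-⊎ (_⊆? F) (_⊆? (F - v)) (incident? F v) split (edges H)
    where
    split : ∀ {x} → x ⊆ F → x ⊆ F - v ⊎ (v ∈ x × x ⊆ F)
    split {x} x⊆F with v ∈? x
    ... | yes v∈x = inj₂ (v∈x , x⊆F)
    ... | no v∉x = inj₁ (λ u∈x → x∈p∧x≢y⇒x∈p-y (x⊆F u∈x) (λ { refl → v∉x u∈x }))

  degenerate-ind : ∀ {A d} → DegenerateOn H A d → (P : Subset (n H) → Set) →
    (∀ {T} → Empty T → P T) →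
    (∀ {T v} → v ∈ T → deg H T v ≤ d → P (T - v) → P T) →
    ∀ T → T ⊆ A → P T
  degenerate-ind {A} degen P base step T T⊆A = go T T⊆A (<-wellFounded ∣ T ∣)
    where
    go : ∀ T → T ⊆ A → Acc _<_ ∣ T ∣ → P T
    go T T⊆A (acc smaller) with nonempty? T
    ... | no T-empty = base T-empty
    ... | yes T-nonempty with degen T T⊆A T-nonempty
    ... | v , v∈T , deg≤d = step v∈T deg≤d
      (go (T - v) (λ u∈T-v → T⊆A (p─q⊆p T ⁅ v ⁆ u∈T-v)) (smaller (x∈p⇒∣p-x∣<∣p∣ v∈T)))

  e≤d*∣F∣ : 1 ≤ r → ∀ {d} → Degenerate H d → ∀ F → e H F ≤ d * ∣ F ∣
  e≤d*∣F∣ r≥1 {d} degen F = degenerate-ind degen (λ F → e H F ≤ d * ∣ F ∣) base step F ⊆⊤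
    where
    base : ∀ {F} → Empty F → e H F ≤ d * ∣ F ∣
    base {F} F-empty = subst (_≤ d * ∣ F ∣) (sym (e-empty r≥1 F-empty)) z≤n

    step : ∀ {F v} → v ∈ F → deg H F v ≤ d → e H (F - v) ≤ d * ∣ F - v ∣ → e H F ≤ d * ∣ F ∣
    step {F} {v} v∈F deg≤d ih = begin
      e H F                    ≤⟨ e≤e[F-v]+deg F v ⟩
      e H (F - v) + deg H F v  ≤⟨ +-mono-≤ ih deg≤d ⟩
      d * ∣ F - v ∣ + d        ≡⟨ +-comm _ d ⟩
      d + d * ∣ F - v ∣        ≡⟨ *-suc d _ ⟨
      d * suc ∣ F - v ∣        ≤⟨ *-monoʳ-≤ d (x∈p⇒∣p-x∣<∣p∣ v∈F) ⟩
      d * ∣ F ∣                ∎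
      where open ≤-Reasoning

  degenerate⇒Mad≤ : 1 ≤ r → ∀ {d} → Degenerate H d → Mad≤ H (r * d)
  degenerate⇒Mad≤ r≥1 {d} degen F _ = begin
    r * e H F        ≤⟨ *-monoʳ-≤ r (e≤d*∣F∣ r≥1 degen F) ⟩
    r * (d * ∣ F ∣)  ≡⟨ *-assoc r d _ ⟨
    r * d * ∣ F ∣    ∎
    where open ≤-Reasoning

  ∈-class⁺ : ∀ f {i u} → f u ≡ i → u ∈ class H f i
  ∈-class⁺ f {u = u} refl = lookup⇒[]= u _
    (trans (lookup∘tabulate _ u) (cong (λ b → if b then inside else outside) (dec-true (f u ≟ f u) refl)))

  ∈-class⁻ : ∀ f {i u} → u ∈ class H f i → f u ≡ i
  ∈-class⁻ f {i} {u} u∈class with f u ≟ i | trans (sym (lookup∘tabulate _ u)) ([]=⇒lookup u∈class)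
  ... | yes fu≡i | _ = fu≡i
  ... | no _     | ()

  extendedClass : Subset (n H) → (V → Fin r) → V → Fin r → Subset (n H)
  extendedClass T f v j = T ∩ (class H f j ∪ ⁅ v ⁆)

  ∈-extendedClass⁻ : ∀ {T} f {v j u} → u ∈ extendedClass T f v j → u ≢ v → f u ≡ j
  ∈-extendedClass⁻ {T} f {v} {j} u∈C u≢v with x∈p∪q⁻ (class H f j) ⁅ v ⁆ (proj₂ (x∈p∩q⁻ T _ u∈C))
  ... | inj₁ u∈class = ∈-class⁻ f u∈class
  ... | inj₂ u∈⁅v⁆   = contradiction (x∈⁅y⁆⇒x≡y v u∈⁅v⁆) u≢v

  ∑-deg-extendedClass≤deg : ∀ T f v → ∑[ j < r ] deg H (extendedClass T f v j) v ≤ deg H T v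
  ∑-deg-extendedClass≤deg T f v =
    ∑-length-filter≤ (λ j → incident? (extendedClass T f v j) v) (incident? T v)
      (λ (v∈x , x⊆C) → v∈x , λ u∈x → proj₁ (x∈p∩q⁻ T _ (x⊆C u∈x)))
      (All.map single-class (uniform H))
    where
    single-class : ∀ {x} → ∣ x ∣ ≡ r → ∀ {i j} →
      v ∈ x × x ⊆ extendedClass T f v i → v ∈ x × x ⊆ extendedClass T f v j → i ≡ j
    single-class {x} ∣x∣≡r {i} {j} (_ , x⊆Cᵢ) (_ , x⊆Cⱼ) with i ≟ j
    ... | yes i≡j = i≡j
    ... | no i≢j = contradiction (Fin-unique r≤1 i j) i≢j
      where
      x⊆⁅v⁆ : x ⊆ ⁅ v ⁆
      x⊆⁅v⁆ {u} u∈x with u ≟ v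
      ... | yes refl = x∈⁅x⁆ v
      ... | no u≢v   = contradiction
        (trans (sym (∈-extendedClass⁻ f (x⊆Cᵢ u∈x) u≢v)) (∈-extendedClass⁻ f (x⊆Cⱼ u∈x) u≢v)) i≢j

      r≤1 : r ≤ 1
      r≤1 = begin
        r          ≡⟨ ∣x∣≡r ⟨
        ∣ x ∣      ≤⟨ p⊆q⇒∣p∣≤∣q∣ x⊆⁅v⁆ ⟩
        ∣ ⁅ v ⁆ ∣  ≡⟨ ∣⁅x⁆∣≡1 v ⟩
        1          ∎
        where open ≤-Reasoning

  DegeneratePartitionOn : ℕ → Subset (n H) → (V → Fin r) → Set
  DegeneratePartitionOn k T f = ∀ i → DegenerateOn H (T ∩ class H f i) k

  ∈-class-updateAt⁻ : ∀ f {v j i u} → u ∈ class H (updateAt f v (const j)) i → u ≢ v → f u ≡ i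
  ∈-class-updateAt⁻ f {v} {j} {u = u} u∈class u≢v =
    trans (sym (updateAt-minimal u v f u≢v)) (∈-class⁻ (updateAt f v (const j)) u∈class)

  recolour : ∀ {k T v j} {f : V → Fin r} →
    DegeneratePartitionOn k (T - v) f → deg H (extendedClass T f v j) v ≤ k →
    DegeneratePartitionOn k T (updateAt f v (const j))
  recolour {k} {T} {v} {j} {f} partition deg≤k i S S⊆ S-nonempty with v ∈? S
  ... | yes v∈S = v , v∈S , ≤-trans (deg-mono v S⊆extendedClass) deg≤k
    where
    j≡i : j ≡ i
    j≡i = trans (sym (updateAt-updates v f)) (∈-class⁻ (updateAt f v (const j)) (proj₂ (x∈p∩q⁻ T _ (S⊆ v∈S))))

    S⊆extendedClass : S ⊆ extendedClass T f v j
    S⊆extendedClass {u} u∈S with x∈p∩q⁻ T _ (S⊆ u∈S) | u ≟ v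
    ... | u∈T , _       | yes refl = x∈p∩q⁺ (u∈T , x∈p∪q⁺ (inj₂ (x∈⁅x⁆ v)))
    ... | u∈T , u∈class | no u≢v   =
      x∈p∩q⁺ (u∈T , x∈p∪q⁺ (inj₁ (∈-class⁺ f (trans (∈-class-updateAt⁻ f u∈class u≢v) (sym j≡i)))))
  ... | no v∉S = partition i S S⊆[T-v]∩class S-nonempty
    where
    S⊆[T-v]∩class : S ⊆ (T - v) ∩ class H f i
    S⊆[T-v]∩class {u} u∈S with x∈p∩q⁻ T _ (S⊆ u∈S)
    ... | u∈T , u∈class = x∈p∩q⁺ (x∈p∧x≢y⇒x∈p-y u∈T u≢v , ∈-class⁺ f (∈-class-updateAt⁻ f u∈class u≢v))
      where
      u≢v : u ≢ v
      u≢v refl = v∉S u∈S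

  degenerate⇒partition : ∀ {d k} → Degenerate H d → d < r * suc k →
    Σ (V → Fin r) (λ f → ∀ i → DegenerateOn H (class H f i) k)
  degenerate⇒partition {d} {k} degen d<r*[1+k] =
    let f , partition = degenerate-ind degen (Σ (V → Fin r) ∘ DegeneratePartitionOn k) base step ⊤ ⊆⊤
    in f , λ i S S⊆class → partition i S (λ u∈S → x∈p∩q⁺ (∈⊤ , S⊆class u∈S))
    where
    base : ∀ {T} → Empty T → Σ (V → Fin r) (DegeneratePartitionOn k T)
    base {T} T-empty = const colour₀ , λ i S S⊆ (u , u∈S) →
      contradiction (u , proj₁ (x∈p∩q⁻ T _ (S⊆ u∈S))) T-empty
      where
      colour₀ : Fin r
      colour₀ = fromℕ< (*-cancelʳ-< (suc k) 0 r (≤-<-trans z≤n d<r*[1+k]))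

    step : ∀ {T v} → v ∈ T → deg H T v ≤ d →
      Σ (V → Fin r) (DegeneratePartitionOn k (T - v)) → Σ (V → Fin r) (DegeneratePartitionOn k T)
    step {T} {v} _ deg≤d (f , partition)
      with j , deg≤k ← pigeonhole-∑ r k (λ j → deg H (extendedClass T f v j) v)
                         (≤-<-trans (∑-deg-extendedClass≤deg T f v) (≤-<-trans deg≤d d<r*[1+k]))
      = updateAt f v (const j) , recolour partition deg≤k

lemma4 : (r : ℕ) → 1 ≤ r → (k : ℕ) → (H : Hypergraph r) →
    (Degenerate H k → Mad≤ H (r * k)) ×
    (Degenerate H (r * (k + 1) ∸ 1) →
      Σ (Fin (n H) → Fin r) (λ f → (i : Fin r) → DegenerateOn H (class H f i) k))
lemma4 r r≥1 k H = degenerate⇒Mad≤ H r≥1 , λ degen → degenerate⇒partition H degen d<r*[1+k]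
  where
  d<r*[1+k] : r * (k + 1) ∸ 1 < r * suc k
  d<r*[1+k] rewrite +-comm k 1 = ∸-monoʳ-< z<s (≤-trans r≥1 (m≤m*n r (suc k)))
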